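{- Let $n, m$ be positive integers with $m \geq 2$ and $n \geq 2m-1$, and let $\beta_m \in S_n$ be an $m$-cycle. Then \begin{enumerate} \item $c(2m, \beta_m) = m!\,(n-m)!\binom{n-m}{m}$; \item $c(2m-1, \beta_m) = m\,(n-m)!\,m!\binom{n-m}{m-1}$. \end{enumerate}
   Context: $S_n$ is the group of permutations of $[n]=\{1,\dots,n\}$; products are composed right to left ($\alpha\beta$ means apply $\beta$ first). The Hamming distance between $\sigma,\tau\in S_n$ is $H(\sigma,\tau)=|\{a\in[n]:\sigma(a)\neq\tau(a)\}|$. Two permutations $\alpha,\beta\in S_n$ $k$-commute if $H(\alpha\beta,\beta\alpha)=k$. For $\beta\in S_n$ and a nonnegative integer $k$, $c(k,\beta)$ denotes the number of $\alpha\in S_n$ that $k$-commute with $\beta$. An $m$-cycle in $S_n$ is a permutation whose disjoint cycle factorization consists of one cycle of length $m$ and $n-m$ fixed points. $\binom{a}{b}=0$ if $b>a$. -}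

module Defs where

open import Data.Nat using (ℕ; zero; suc; _%_)
open import Data.Nat.DivMod using (m%n<n)
open import Data.Fin using (Fin; toℕ; fromℕ<) renaming (_≟_ to _≟ᶠ_)
open import Data.Vec using (Vec; lookup; tabulate; toList; []; _∷_)
open import Data.List using (List; []; _∷_; length; filter; concatMap; map; allFin)
open import Data.List.Relation.Unary.Unique.Propositional using (Unique)
import Data.List.Relation.Unary.Unique.DecPropositional as UDec
open import Data.Product using (Σ; _×_)
open import Relation.Nullary using (Dec; ¬_; ¬?)
open import Relation.Nullary.Decidable using (_×-dec_)
open import Relation.Binary.PropositionalEquality using (_≡_; _≢_)
import Data.Nat as ℕ
open import Function.Definitions using (Injective)

-- A permutation of [n] = Fin n is represented by its table of values
-- σ = (σ(0), …, σ(n-1)) : Vec (Fin n) n whose entries are pairwise distinct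
-- (i.e. a ↦ lookup σ a is injective, hence bijective on the finite set Fin n).
Perm : ℕ → Set
Perm n = Vec (Fin n) n

IsPerm : ∀ {n} → Perm n → Set
IsPerm σ = Unique (toList σ)

isPerm? : ∀ {n} (σ : Perm n) → Dec (IsPerm σ)
isPerm? {n} σ = UDec.unique? _≟ᶠ_ (toList σ)

_∘ₚ_ : ∀ {n} → Perm n → Perm n → Perm n
α ∘ₚ β = tabulate (λ a → lookup α (lookup β a))

H : ∀ {n} → Perm n → Perm n → ℕ
H {n} σ τ = length (filter (λ a → ¬? (lookup σ a ≟ᶠ lookup τ a)) (allFin n))

allVecs : (n k : ℕ) → List (Vec (Fin n) k)
allVecs n zero = [] ∷ []
allVecs n (suc k) = concatMap (λ x → map (x ∷_) (allVecs n k)) (allFin n)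

KCommute : ∀ {n} → ℕ → Perm n → Perm n → Set
KCommute k α β = H (α ∘ₚ β) (β ∘ₚ α) ≡ k

c : ∀ {n} → ℕ → Perm n → ℕ
c {n} k β = length (filter (λ α → isPerm? α ×-dec (H (α ∘ₚ β) (β ∘ₚ α) ℕ.≟ k)) (allVecs n n))

csuc : ∀ {m} → Fin m → Fin m
csuc {suc k} i = fromℕ< (m%n<n (suc (toℕ i)) (suc k))

IsCycle : ∀ {n} → ℕ → Perm n → Set
IsCycle {n} m β =
  IsPerm β ×
  Σ (Fin m → Fin n) (λ a →
      Injective _≡_ _≡_ a ×
      ((i : Fin m) → lookup β (a i) ≡ a (csuc i)) ×
      ((x : Fin n) → ((i : Fin m) → a i ≢ x) → lookup β x ≡ x))

-- Let A be the support of β and, for a permutation α, call x a mismatch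
-- when αβx ≠ βαx, so that H(αβ, βα) counts the mismatches.  Each x ∈ A with
-- αx ∉ A and each x ∉ A with αx ∈ A is a mismatch, while no x with x, αx ∉ A
-- is.  If t points of A stay in A under α, both kinds of crossing points
-- number m - t, so H + 2t = 2m + s where s ≤ t counts the mismatches among
-- the staying points; moreover s = 1 when t = 1.  Hence H = 2m iff t = 0 and
-- H = 2m - 1 iff t = 1 (CycleCommutation.H-values).
--
-- It remains to count permutations by t.  Since c(k, β) enumerates all
-- tables of values, we count injective words whose positions are tagged by
-- membership of A (FreshWords.count-fresh) through an explicit recursion
-- (placements) whose values at t = 0 and t = 1 are closed forms in falling
-- factorials (placements-0, placements-1), which are then rewritten with
-- binomial coefficients.
module Submission where

open import Defs
open import Data.Nat using (ℕ; zero; suc; pred; _+_; _*_; _∸_; _≤_; _<_; _<?_; _!; z≤n; s≤s; s≤s⁻¹; _≟_)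
open import Data.Nat.Properties
open import Data.Nat.Combinatorics using (_C_; nCk+nC[k+1]≡[n+1]C[k+1])
open import Data.Nat.DivMod using (_%_; n%n≡0; m<n⇒m%n≡m)
open import Data.Nat.Tactic.RingSolver using (solve-∀)
open import Data.Bool using (Bool; true; false; not; _∧_; _∨_)
open import Data.Bool.Properties
  using (∨-identityʳ; ∨-conicalˡ; ∨-conicalʳ; ∧-conicalˡ; ∧-conicalʳ; ∧-zeroʳ; ∧-comm; ∧-identityʳ)
open import Data.Fin using (Fin; zero; suc; toℕ) renaming (_≟_ to _≟ᶠ_)
open import Data.Fin.Properties using (any?; toℕ-fromℕ<; toℕ<n)
import Data.Fin.Properties as Fin
open import Data.Vec using (Vec; []; _∷_; lookup; tabulate; toList)
open import Data.Vec.Properties using (lookup∘tabulate)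
open import Data.List as List using (List; []; _∷_; _++_; length; filter; map; concatMap; allFin)
open import Data.List.Relation.Unary.All as All using (All; []; _∷_)
open import Data.List.Relation.Unary.AllPairs using ([]; _∷_)
open import Data.List.Relation.Unary.Unique.Propositional using (Unique)
open import Data.Product using (_×_; _,_; proj₁; proj₂)
open import Data.Empty using (⊥-elim)
open import Relation.Nullary using (Dec; yes; no; does; ¬_)
open import Relation.Nullary.Decidable using (dec-true; dec-false; does-⇔)
open import Relation.Binary.PropositionalEquality
open import Function using (_∘_; id)
open import Function.Bundles using (_⇔_; mk⇔)
open import Function.Definitions using (Injective)
open import Algebra.Properties.Semiring.Sum +-*-semiring
  using (sum; sum-syntax; sum-cong-≗; ∑-distrib-+; ∑-comm; *-distribʳ-sum; sum-replicate-zero)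

𝟙 : Bool → ℕ
𝟙 true  = 1
𝟙 false = 0

𝟙≤1 : ∀ b → 𝟙 b ≤ 1
𝟙≤1 true  = s≤s z≤n
𝟙≤1 false = z≤n

𝟙-split : ∀ b d → 𝟙 b ≡ 𝟙 (b ∧ not d) + 𝟙 (b ∧ d)
𝟙-split true  true  = refl
𝟙-split true  false = refl
𝟙-split false d     = refl

𝟙-∧-≤ : ∀ b d → 𝟙 (b ∧ d) ≤ 𝟙 b
𝟙-∧-≤ true  d = 𝟙≤1 d
𝟙-∧-≤ false d = z≤n

𝟙-complement : ∀ b → 𝟙 b + 𝟙 (not b) ≡ 1
𝟙-complement true  = refl
𝟙-complement false = refl

sum-mono-≤ : ∀ {n} {f g : Fin n → ℕ} → (∀ x → f x ≤ g x) → sum f ≤ sum g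
sum-mono-≤ {zero}  le = z≤n
sum-mono-≤ {suc n} le = +-mono-≤ (le zero) (sum-mono-≤ (le ∘ suc))

sum-zero : ∀ {n} {f : Fin n → ℕ} → (∀ x → f x ≡ 0) → sum f ≡ 0
sum-zero {n} f≡0 = trans (sum-cong-≗ f≡0) (sum-replicate-zero n)

sum-ones : ∀ n → ∑[ x < n ] 1 ≡ n
sum-ones zero    = refl
sum-ones (suc n) = cong suc (sum-ones n)

sum-single : ∀ {n} {f : Fin n → ℕ} (x : Fin n) →
             f x ≡ 1 → (∀ y → y ≢ x → f y ≡ 0) → sum f ≡ 1
sum-single {suc n} zero    fx≡1 rest≡0 =
  cong₂ _+_ fx≡1 (sum-zero (λ y → rest≡0 (suc y) (λ ())))
sum-single {suc n} (suc x) fx≡1 rest≡0 =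
  cong₂ _+_ (rest≡0 zero (λ ()))
            (sum-single x fx≡1 (λ y y≢x → rest≡0 (suc y) (y≢x ∘ Fin.suc-injective)))

sum-≥-term : ∀ {n} (f : Fin n → ℕ) (x : Fin n) → f x ≤ sum f
sum-≥-term f zero    = m≤m+n _ _
sum-≥-term f (suc x) = ≤-trans (sum-≥-term (f ∘ suc) x) (m≤n+m _ _)

sum-≥-pair : ∀ {n} (f : Fin n → ℕ) {x y : Fin n} → x ≢ y → f x + f y ≤ sum f
sum-≥-pair f {zero}  {zero}  x≢y = ⊥-elim (x≢y refl)
sum-≥-pair f {zero}  {suc y} x≢y = +-monoʳ-≤ (f zero) (sum-≥-term (f ∘ suc) y)
sum-≥-pair f {suc x} {zero}  x≢y =
  subst (_≤ sum f) (+-comm (f zero) (f (suc x))) (+-monoʳ-≤ (f zero) (sum-≥-term (f ∘ suc) x))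
sum-≥-pair f {suc x} {suc y} x≢y =
  ≤-trans (sum-≥-pair (f ∘ suc) (x≢y ∘ cong suc)) (m≤n+m _ _)

sum-all-one : ∀ {n} (f : Fin n → ℕ) → (∀ x → f x ≤ 1) → sum f ≡ n → ∀ x → f x ≡ 1
sum-all-one {suc n} f f≤1 total x = go x
  where
  rest≤n : sum (f ∘ suc) ≤ n
  rest≤n = subst (sum (f ∘ suc) ≤_) (sum-ones n) (sum-mono-≤ (f≤1 ∘ suc))

  head≡1 : ∀ v → v ≤ 1 → v + sum (f ∘ suc) ≡ suc n → v ≡ 1
  head≡1 zero          _         e = ⊥-elim (1+n≰n (subst (_≤ n) e rest≤n))
  head≡1 (suc zero)    _         _ = refl
  head≡1 (suc (suc _)) (s≤s ()) _

  f0≡1 : f zero ≡ 1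
  f0≡1 = head≡1 (f zero) (f≤1 zero) total

  go : ∀ x → f x ≡ 1
  go zero    = f0≡1
  go (suc x) = sum-all-one (f ∘ suc) (f≤1 ∘ suc)
                 (suc-injective (trans (cong (_+ sum (f ∘ suc)) (sym f0≡1)) total)) x

does-false⇒¬ : ∀ {P : Set} (P? : Dec P) → does P? ≡ false → ¬ P
does-false⇒¬ (yes _) ()
does-false⇒¬ (no ¬p) _ = ¬p

≟-sym : ∀ {n} (x y : Fin n) → does (x ≟ᶠ y) ≡ does (y ≟ᶠ x)
≟-sym x y with x ≟ᶠ y
... | yes refl = sym (dec-true (x ≟ᶠ x) refl)
... | no x≢y   = sym (dec-false (y ≟ᶠ x) (x≢y ∘ sym))

sum-δ : ∀ {n} (x : Fin n) → ∑[ y < n ] 𝟙 (does (x ≟ᶠ y)) ≡ 1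
sum-δ x = sum-single x (cong 𝟙 (dec-true (x ≟ᶠ x) refl))
                       (λ y y≢x → cong 𝟙 (dec-false (x ≟ᶠ y) (y≢x ∘ sym)))

count-preimages : ∀ {k n} (g : Fin k → Fin n) → Injective _≡_ _≡_ g → ∀ y →
  ∑[ i < k ] 𝟙 (does (g i ≟ᶠ y)) ≡ 𝟙 (does (any? (λ i → g i ≟ᶠ y)))
count-preimages g g-inj y with any? (λ i → g i ≟ᶠ y)
... | yes (i , gi≡y) = sum-single i (cong 𝟙 (dec-true (g i ≟ᶠ y) gi≡y))
        (λ j j≢i → cong 𝟙 (dec-false (g j ≟ᶠ y) (λ gj≡y → j≢i (g-inj (trans gj≡y (sym gi≡y))))))
... | no  ∄i = sum-zero (λ i → cong 𝟙 (dec-false (g i ≟ᶠ y) (λ gi≡y → ∄i (i , gi≡y))))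

sumOver : {A : Set} → (A → ℕ) → List A → ℕ
sumOver g []       = 0
sumOver g (x ∷ xs) = g x + sumOver g xs

sumOver-cong : {A : Set} {f g : A → ℕ} (xs : List A) → (∀ x → f x ≡ g x) →
               sumOver f xs ≡ sumOver g xs
sumOver-cong []       f≡g = refl
sumOver-cong (x ∷ xs) f≡g = cong₂ _+_ (f≡g x) (sumOver-cong xs f≡g)

sumOver-zero : {A : Set} {g : A → ℕ} (xs : List A) → (∀ x → g x ≡ 0) → sumOver g xs ≡ 0
sumOver-zero []       g≡0 = refl
sumOver-zero (x ∷ xs) g≡0 = cong₂ _+_ (g≡0 x) (sumOver-zero xs g≡0)

length-filter : {A : Set} {P : A → Set} (P? : ∀ x → Dec (P x)) (xs : List A) →
                length (filter P? xs) ≡ sumOver (λ x → 𝟙 (does (P? x))) xs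
length-filter P? []       = refl
length-filter P? (x ∷ xs) with does (P? x)
... | true  = cong suc (length-filter P? xs)
... | false = length-filter P? xs

sumOver-++ : {A : Set} (g : A → ℕ) (xs ys : List A) →
             sumOver g (xs ++ ys) ≡ sumOver g xs + sumOver g ys
sumOver-++ g []       ys = refl
sumOver-++ g (x ∷ xs) ys = trans (cong (g x +_) (sumOver-++ g xs ys)) (sym (+-assoc (g x) _ _))

sumOver-map : {A B : Set} (g : B → ℕ) (h : A → B) (xs : List A) →
              sumOver g (map h xs) ≡ sumOver (g ∘ h) xs
sumOver-map g h []       = refl
sumOver-map g h (x ∷ xs) = cong (g (h x) +_) (sumOver-map g h xs)

sumOver-concatMap : {A B : Set} (g : B → ℕ) (h : A → List B) (xs : List A) →
                    sumOver g (concatMap h xs) ≡ sumOver (sumOver g ∘ h) xs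
sumOver-concatMap g h []       = refl
sumOver-concatMap g h (x ∷ xs) =
  trans (sumOver-++ g (h x) (concatMap h xs)) (cong (sumOver g (h x) +_) (sumOver-concatMap g h xs))

sumOver-allFin : ∀ n (g : Fin n → ℕ) → sumOver g (allFin n) ≡ sum g
sumOver-allFin n g = go n id
  where
  go : ∀ k (f : Fin k → Fin n) → sumOver g (List.tabulate f) ≡ sum (g ∘ f)
  go zero    f = refl
  go (suc k) f = cong (g (f zero) +_) (go k (f ∘ suc))

sumOver-allVecs : ∀ n k (g : Vec (Fin n) (suc k) → ℕ) →
  sumOver g (allVecs n (suc k)) ≡ ∑[ x < n ] sumOver (λ w → g (x ∷ w)) (allVecs n k)
sumOver-allVecs n k g = begin
  sumOver g (concatMap (λ x → map (x ∷_) (allVecs n k)) (allFin n))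
    ≡⟨ sumOver-concatMap g _ (allFin n) ⟩
  sumOver (λ x → sumOver g (map (x ∷_) (allVecs n k))) (allFin n)
    ≡⟨ sumOver-cong (allFin n) (λ x → sumOver-map g (x ∷_) (allVecs n k)) ⟩
  sumOver (λ x → sumOver (λ w → g (x ∷ w)) (allVecs n k)) (allFin n)
    ≡⟨ sumOver-allFin n _ ⟩
  ∑[ x < n ] sumOver (λ w → g (x ∷ w)) (allVecs n k) ∎
  where open ≡-Reasoning

image-size : ∀ {k n} (g : Fin k → Fin n) → Injective _≡_ _≡_ g → (h : Fin n → Fin n) →
  (∀ y → ∑[ x < n ] 𝟙 (does (y ≟ᶠ h x)) ≡ 1) →
  ∑[ x < n ] 𝟙 (does (any? (λ i → g i ≟ᶠ h x))) ≡ k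
image-size {k} {n} g g-inj h h-bij = begin
  ∑[ x < n ] 𝟙 (does (any? (λ i → g i ≟ᶠ h x)))  ≡⟨ sum-cong-≗ (λ x → count-preimages g g-inj (h x)) ⟨
  ∑[ x < n ] ∑[ i < k ] 𝟙 (does (g i ≟ᶠ h x))       ≡⟨ ∑-comm (λ x i → 𝟙 (does (g i ≟ᶠ h x))) ⟩
  ∑[ i < k ] ∑[ x < n ] 𝟙 (does (g i ≟ᶠ h x))       ≡⟨ sum-cong-≗ (h-bij ∘ g) ⟩
  ∑[ i < k ] 1                                       ≡⟨ sum-ones k ⟩
  k                                                  ∎
  where open ≡-Reasoning

infixl 8 _↓_
_↓_ : ℕ → ℕ → ℕ
q     ↓ zero  = 1
zero  ↓ suc k = 0
suc q ↓ suc k = suc q * (q ↓ k)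

↓-suc : ∀ q k → q * (pred q ↓ k) ≡ q ↓ suc k
↓-suc zero    k = refl
↓-suc (suc q) k = refl

↓-recurrence : ∀ q a → q ↓ suc a + a * (q ↓ a) ≡ q * (q ↓ a)
↓-recurrence zero    zero    = refl
↓-recurrence zero    (suc a) = *-zeroʳ (suc a)
↓-recurrence (suc q) zero    = +-identityʳ _
↓-recurrence (suc q) (suc a) = begin
  suc q * (q ↓ suc a) + suc a * (suc q * (q ↓ a))    ≡⟨ regroup q a (q ↓ suc a) (q ↓ a) ⟩
  suc q * ((q ↓ suc a + a * (q ↓ a)) + q ↓ a)        ≡⟨ cong (λ z → suc q * (z + q ↓ a)) (↓-recurrence q a) ⟩
  suc q * (q * (q ↓ a) + q ↓ a)                      ≡⟨ cong (suc q *_) (+-comm (q * (q ↓ a)) _) ⟩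
  suc q * (suc q * (q ↓ a))                          ∎
  where
  open ≡-Reasoning
  regroup : ∀ q a z y → suc q * z + suc a * (suc q * y) ≡ suc q * ((z + a * y) + y)
  regroup = solve-∀

-- The form of the recurrence used for placements below: when p red and q
-- blue points remain for a red-tagged and b+1 blue-tagged positions
-- (p + q = a + b + 1), then p·(q↓a) + q↓(a+1) = (b+1)·(q↓a).
↓-fill : ∀ {a b p q} → p + q ≡ a + suc b → p * (q ↓ a) + q ↓ suc a ≡ suc b * (q ↓ a)
↓-fill {a} {b} {p} {q} e = +-cancelʳ-≡ (a * X) _ _ (begin
  p * X + q ↓ suc a + a * X    ≡⟨ +-assoc (p * X) _ _ ⟩
  p * X + (q ↓ suc a + a * X)  ≡⟨ cong (p * X +_) (↓-recurrence q a) ⟩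
  p * X + q * X                ≡⟨ *-distribʳ-+ X p q ⟨
  (p + q) * X                  ≡⟨ cong (_* X) e ⟩
  (a + suc b) * X              ≡⟨ *-distribʳ-+ X a (suc b) ⟩
  a * X + suc b * X            ≡⟨ +-comm (a * X) _ ⟩
  suc b * X + a * X            ∎)
  where
  open ≡-Reasoning
  X = q ↓ a

↓≡!*C : ∀ q k → q ↓ k ≡ k ! * (q C k)
↓≡!*C q       zero    = refl
↓≡!*C zero    (suc k) = sym (*-zeroʳ (suc k !))
↓≡!*C (suc q) (suc k) = begin
  suc q * (q ↓ k)                             ≡⟨ pascal ⟨
  suc k * (q ↓ k) + q ↓ suc k                 ≡⟨ cong₂ (λ u v → suc k * u + v) (↓≡!*C q k) (↓≡!*C q (suc k)) ⟩
  suc k * (k ! * (q C k)) + suc k ! * (q C suc k)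
                                              ≡⟨ cong (_+ suc k ! * (q C suc k)) (*-assoc (suc k) (k !) _) ⟨
  suc k ! * (q C k) + suc k ! * (q C suc k)   ≡⟨ *-distribˡ-+ (suc k !) _ _ ⟨
  suc k ! * (q C k + q C suc k)               ≡⟨ cong (suc k ! *_) (nCk+nC[k+1]≡[n+1]C[k+1] q k) ⟩
  suc k ! * (suc q C suc k)                   ∎
  where
  open ≡-Reasoning
  pascal : suc k * (q ↓ k) + q ↓ suc k ≡ suc q * (q ↓ k)
  pascal = begin
    suc k * (q ↓ k) + q ↓ suc k              ≡⟨ +-comm (q ↓ k + k * (q ↓ k)) _ ⟩
    q ↓ suc k + (q ↓ k + k * (q ↓ k))        ≡⟨ cong (q ↓ suc k +_) (+-comm (q ↓ k) _) ⟩
    q ↓ suc k + (k * (q ↓ k) + q ↓ k)        ≡⟨ +-assoc (q ↓ suc k) _ _ ⟨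
    q ↓ suc k + k * (q ↓ k) + q ↓ k          ≡⟨ cong (_+ q ↓ k) (↓-recurrence q k) ⟩
    q * (q ↓ k) + q ↓ k                      ≡⟨ +-comm (q * (q ↓ k)) _ ⟩
    suc q * (q ↓ k)                          ∎

↓-pred : ∀ q a → q * (a * (pred q ↓ pred a)) ≡ a * (q ↓ a)
↓-pred q zero    = *-zeroʳ q
↓-pred q (suc a) = begin
  q * (suc a * (pred q ↓ a))  ≡⟨ *-assoc q (suc a) _ ⟨
  q * suc a * (pred q ↓ a)    ≡⟨ cong (_* (pred q ↓ a)) (*-comm q (suc a)) ⟩
  suc a * q * (pred q ↓ a)    ≡⟨ *-assoc (suc a) q _ ⟩
  suc a * (q * (pred q ↓ a))  ≡⟨ cong (suc a *_) (↓-suc q a) ⟩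
  suc a * (q ↓ suc a)         ∎
  where open ≡-Reasoning

closed-form-0 : ∀ q k → q ↓ k * q ! ≡ k ! * q ! * (q C k)
closed-form-0 q k = trans (cong (_* q !) (↓≡!*C q k)) (swap (k !) (q C k) (q !))
  where
  swap : ∀ x y z → x * y * z ≡ x * z * y
  swap = solve-∀

closed-form-1 : ∀ q k → k * k * (q ↓ pred k) * q ! ≡ k * q ! * k ! * (q C (k ∸ 1))
closed-form-1 q zero    = refl
closed-form-1 q (suc k) = trans (cong (λ z → suc k * suc k * z * q !) (↓≡!*C q k)) (regroup k (k !) (q C k) (q !))
  where
  regroup : ∀ k f b q! → suc k * suc k * (f * b) * q! ≡ suc k * q! * (suc k * f) * b
  regroup = solve-∀

-- Positions carry tags (true = red-tagged) and p red and
-- q blue points are available.  placements tags p q t counts the injective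
-- fillings of the positions by available points in which exactly t
-- red-tagged positions receive a red point: the first position takes one of
-- the p red points (scoring a hit if it is red-tagged) or one of the q blue ones.
placements : ∀ {k} → Vec Bool k → ℕ → ℕ → ℕ → ℕ
afterRed   : ∀ {k} → Bool → Vec Bool k → ℕ → ℕ → ℕ → ℕ
placements []           p q t = 𝟙 (does (0 ≟ t))
placements (tag ∷ tags) p q t = p * afterRed tag tags p q t + q * placements tags p (pred q) t

-- The count for the remaining positions once the first one got a red point.
afterRed true  tags p q zero    = 0
afterRed true  tags p q (suc t) = placements tags (pred p) q t
afterRed false tags p q t       = placements tags (pred p) q t

reds blues : ∀ {k} → Vec Bool k → ℕ
reds  []       = 0
reds  (b ∷ bs) = 𝟙 b + reds bs
blues []       = 0
blues (b ∷ bs) = 𝟙 (not b) + blues bs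

*-pred-cong : ∀ p {g h : ℕ → ℕ} → (∀ p' → suc p' ≡ p → g p' ≡ h p') → p * g (pred p) ≡ p * h (pred p)
*-pred-cong zero     _   = refl
*-pred-cong (suc p') g≡h = cong (suc p' *_) (g≡h p' refl)

drop-red : ∀ {p' p q s} → suc p' ≡ p → p + q ≡ suc s → p' + q ≡ s
drop-red refl e = suc-injective e

drop-blue : ∀ {p q' q s} → suc q' ≡ q → p + q ≡ suc s → p + q' ≡ s
drop-blue {p} {q'} refl e = suc-injective (trans (sym (+-suc p q')) e)

-- With no hit allowed, the a red-tagged positions take blue points (q↓a ways)
-- and the b blue-tagged positions then exhaust the b points left (b! ways).
placements-0 : ∀ {k} (tags : Vec Bool k) p q → p + q ≡ reds tags + blues tags →
               placements tags p q 0 ≡ q ↓ reds tags * blues tags !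
placements-0 []            p q       e = refl
placements-0 (true ∷ tags) p zero    e = trans (+-identityʳ (p * 0)) (*-zeroʳ p)
placements-0 (true ∷ tags) p (suc q) e =
  trans (cong₂ _+_ (*-zeroʳ p) (cong (suc q *_) (placements-0 tags p q (drop-blue refl e))))
        (sym (*-assoc (suc q) (q ↓ reds tags) _))
placements-0 (false ∷ tags) p q e = begin
  p * placements tags (pred p) q 0 + q * placements tags p (pred q) 0
    ≡⟨ cong₂ _+_ (*-pred-cong p red-first) (*-pred-cong q blue-first) ⟩
  p * (X * B) + q * (pred q ↓ a * B)      ≡⟨ factor p q X (pred q ↓ a) B ⟩
  (p * X + q * (pred q ↓ a)) * B          ≡⟨ cong (λ z → (p * X + z) * B) (↓-suc q a) ⟩
  (p * X + q ↓ suc a) * B                 ≡⟨ cong (_* B) (↓-fill e) ⟩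
  suc b * X * B                           ≡⟨ rearrange (suc b) X B ⟩
  X * (suc b * B)                         ∎
  where
  open ≡-Reasoning
  a = reds tags
  b = blues tags
  X = q ↓ a
  B = b !
  e′ : p + q ≡ suc (a + b)
  e′ = trans e (+-suc a b)
  red-first : ∀ p' → suc p' ≡ p → placements tags p' q 0 ≡ X * B
  red-first p' eq = placements-0 tags p' q (drop-red eq e′)
  blue-first : ∀ q' → suc q' ≡ q → placements tags p q' 0 ≡ q' ↓ a * B
  blue-first q' eq = placements-0 tags p q' (drop-blue eq e′)
  factor : ∀ p q x y z → p * (x * z) + q * (y * z) ≡ (p * x + q * y) * z
  factor = solve-∀
  rearrange : ∀ x y z → x * y * z ≡ y * (x * z)
  rearrange = solve-∀

-- The blue-tagged step of placements-1, as an identity of natural numbers.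
one-hit-fill : ∀ a b p q B → p + q ≡ a + suc b →
  p * (a * pred p * (q ↓ pred a) * B) + q * (a * p * (pred q ↓ pred a) * B)
    ≡ a * p * (q ↓ pred a) * (suc b * B)
one-hit-fill zero    b p       q B e = no-red-tag p q (pred p) (q ↓ 0) (pred q ↓ 0) B (suc b * B)
  where
  no-red-tag : ∀ p q p' x y B C → p * (0 * p' * x * B) + q * (0 * p * y * B) ≡ 0 * p * x * C
  no-red-tag = solve-∀
one-hit-fill (suc a) b zero    q B e = no-red-point q (suc a) (q ↓ a) (pred q ↓ a) B (suc b * B)
  where
  no-red-point : ∀ q a x y B C → 0 * (a * 0 * x * B) + q * (a * 0 * y * B) ≡ a * 0 * x * C
  no-red-point = solve-∀
one-hit-fill (suc a) b (suc p) q B e = begin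
  suc p * (suc a * p * Y * B) + q * (suc a * suc p * (pred q ↓ a) * B)
    ≡⟨ factor (suc a) (suc p) p q Y (pred q ↓ a) B ⟩
  suc a * suc p * B * (p * Y + q * (pred q ↓ a))  ≡⟨ cong (λ z → suc a * suc p * B * (p * Y + z)) (↓-suc q a) ⟩
  suc a * suc p * B * (p * Y + q ↓ suc a)         ≡⟨ cong (suc a * suc p * B *_) (↓-fill (suc-injective e)) ⟩
  suc a * suc p * B * (suc b * Y)                 ≡⟨ rearrange (suc a * suc p) B (suc b) Y ⟩
  suc a * suc p * Y * (suc b * B)                 ∎
  where
  open ≡-Reasoning
  Y = q ↓ a
  factor : ∀ a p' p q y w B → p' * (a * p * y * B) + q * (a * p' * w * B) ≡ a * p' * B * (p * y + q * w)
  factor = solve-∀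
  rearrange : ∀ x B b y → x * B * (b * y) ≡ x * y * (b * B)
  rearrange = solve-∀

-- Exactly one hit: choose its red-tagged position (a ways) and red point
-- (p ways); the other a-1 red-tagged positions take blue points and the
-- blue-tagged positions exhaust the rest.
placements-1 : ∀ {k} (tags : Vec Bool k) p q → p + q ≡ reds tags + blues tags →
               placements tags p q 1 ≡ reds tags * p * (q ↓ pred (reds tags)) * blues tags !
placements-1 []            p q e = refl
placements-1 (true ∷ tags) p q e = begin
  p * placements tags (pred p) q 0 + q * placements tags p (pred q) 1
    ≡⟨ cong₂ _+_ (*-pred-cong p red-first) (*-pred-cong q blue-first) ⟩
  p * (X * B) + q * (a * p * (pred q ↓ pred a) * B)  ≡⟨ cong (p * (X * B) +_) (regroup q a p (pred q ↓ pred a) B) ⟩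
  p * (X * B) + q * (a * (pred q ↓ pred a)) * (p * B) ≡⟨ cong (λ z → p * (X * B) + z * (p * B)) (↓-pred q a) ⟩
  p * (X * B) + a * X * (p * B)                       ≡⟨ collect p a X B ⟩
  suc a * p * X * B                                   ∎
  where
  open ≡-Reasoning
  a = reds tags
  b = blues tags
  X = q ↓ a
  B = b !
  red-first : ∀ p' → suc p' ≡ p → placements tags p' q 0 ≡ X * B
  red-first p' eq = placements-0 tags p' q (drop-red eq e)
  blue-first : ∀ q' → suc q' ≡ q → placements tags p q' 1 ≡ a * p * (q' ↓ pred a) * B
  blue-first q' eq = placements-1 tags p q' (drop-blue eq e)
  regroup : ∀ q a p y B → q * (a * p * y * B) ≡ q * (a * y) * (p * B)
  regroup = solve-∀
  collect : ∀ p a x B → p * (x * B) + a * x * (p * B) ≡ suc a * p * x * B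
  collect = solve-∀
placements-1 (false ∷ tags) p q e =
  trans (cong₂ _+_ (*-pred-cong p red-first) (*-pred-cong q blue-first)) (one-hit-fill a b p q B e)
  where
  a = reds tags
  b = blues tags
  B = b !
  e′ : p + q ≡ suc (a + b)
  e′ = trans e (+-suc a b)
  red-first : ∀ p' → suc p' ≡ p → placements tags p' q 1 ≡ a * p' * (q ↓ pred a) * B
  red-first p' eq = placements-1 tags p' q (drop-red eq e′)
  blue-first : ∀ q' → suc q' ≡ q → placements tags p q' 1 ≡ a * p * (q' ↓ pred a) * B
  blue-first q' eq = placements-1 tags p q' (drop-blue eq e′)

reds-tabulate : ∀ {k} (f : Fin k → Bool) → reds (tabulate f) ≡ ∑[ j < k ] 𝟙 (f j)
reds-tabulate {zero}  f = refl
reds-tabulate {suc k} f = cong (𝟙 (f zero) +_) (reds-tabulate (f ∘ suc))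

blues-tabulate : ∀ {k} (f : Fin k → Bool) → blues (tabulate f) ≡ ∑[ j < k ] 𝟙 (not (f j))
blues-tabulate {zero}  f = refl
blues-tabulate {suc k} f = cong (𝟙 (not (f zero)) +_) (blues-tabulate (f ∘ suc))

module FreshWords {n : ℕ} (red : Fin n → Bool) where

  insert : (Fin n → Bool) → Fin n → Fin n → Bool
  insert u x y = u y ∨ does (x ≟ᶠ y)

  insert-false : ∀ u x y → insert u x y ≡ false → u y ≡ false × x ≢ y
  insert-false u x y e = ∨-conicalˡ (u y) _ e , does-false⇒¬ (x ≟ᶠ y) (∨-conicalʳ (u y) _ e)

  insert-false⁻ : ∀ u x y → u y ≡ false → x ≢ y → insert u x y ≡ false
  insert-false⁻ u x y uy x≢y = trans (cong (_∨ does (x ≟ᶠ y)) uy) (dec-false (x ≟ᶠ y) x≢y)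

  fresh : ∀ {k} → (Fin n → Bool) → Vec (Fin n) k → Bool
  fresh u []      = true
  fresh u (x ∷ v) = not (u x) ∧ fresh (insert u x) v

  fresh-head : ∀ {k} u x (v : Vec (Fin n) k) → fresh u (x ∷ v) ≡ true → u x ≡ false
  fresh-head u x v e with u x | ∧-conicalˡ (not (u x)) _ e
  ... | false | _ = refl

  fresh-tail : ∀ {k} u x (v : Vec (Fin n) k) → fresh u (x ∷ v) ≡ true → fresh (insert u x) v ≡ true
  fresh-tail u x v = ∧-conicalʳ (not (u x)) _

  fresh-avoids : ∀ {k} u (v : Vec (Fin n) k) → fresh u v ≡ true → ∀ j → u (lookup v j) ≡ false
  fresh-avoids u (x ∷ v) e zero    = fresh-head u x v e
  fresh-avoids u (x ∷ v) e (suc j) =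
    proj₁ (insert-false u x _ (fresh-avoids (insert u x) v (fresh-tail u x v e) j))

  fresh-tail-≢ : ∀ {k} u x (v : Vec (Fin n) k) → fresh u (x ∷ v) ≡ true → ∀ j → x ≢ lookup v j
  fresh-tail-≢ u x v e j = proj₂ (insert-false u x _ (fresh-avoids (insert u x) v (fresh-tail u x v e) j))

  fresh-injective : ∀ {k} u (v : Vec (Fin n) k) → fresh u v ≡ true → Injective _≡_ _≡_ (lookup v)
  fresh-injective u (x ∷ v) e {zero}  {zero}  _  = refl
  fresh-injective u (x ∷ v) e {zero}  {suc j} eq = ⊥-elim (fresh-tail-≢ u x v e j eq)
  fresh-injective u (x ∷ v) e {suc i} {zero}  eq = ⊥-elim (fresh-tail-≢ u x v e i (sym eq))
  fresh-injective u (x ∷ v) e {suc i} {suc j} eq =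
    cong suc (fresh-injective (insert u x) v (fresh-tail u x v e) eq)

  fresh⇒unique : ∀ {k} u (v : Vec (Fin n) k) → fresh u v ≡ true →
                 Unique (toList v) × All (λ y → u y ≡ false) (toList v)
  fresh⇒unique u []      e = [] , []
  fresh⇒unique u (x ∷ v) e with fresh⇒unique (insert u x) v (fresh-tail u x v e)
  ... | uniq , avoid =
    All.map (λ {y} iy → proj₂ (insert-false u x y iy)) avoid ∷ uniq ,
    fresh-head u x v e ∷ All.map (λ {y} iy → proj₁ (insert-false u x y iy)) avoid

  unique⇒fresh : ∀ {k} u (v : Vec (Fin n) k) →
                 Unique (toList v) → All (λ y → u y ≡ false) (toList v) → fresh u v ≡ true
  unique⇒fresh u []      _           _           = refl
  unique⇒fresh u (x ∷ v) (x∉v ∷ uniq) (ux ∷ avoid) rewrite ux =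
    unique⇒fresh (insert u x) v uniq
      (All.zipWith (λ {y} (x≢y , uy) → insert-false⁻ u x y uy x≢y) (x∉v , avoid))

  ∅ : Fin n → Bool
  ∅ _ = false

  isPerm≡fresh : (α : Perm n) → does (isPerm? α) ≡ fresh ∅ α
  isPerm≡fresh α with isPerm? α | fresh ∅ α in e
  ... | yes uniq | true  = refl
  ... | yes uniq | false = sym (trans (sym e) (unique⇒fresh ∅ α uniq (All.universal (λ _ → refl) _)))
  ... | no ¬uniq | true  = ⊥-elim (¬uniq (proj₁ (fresh⇒unique ∅ α e)))
  ... | no ¬uniq | false = refl

  hits : ∀ {k} → Vec Bool k → Vec (Fin n) k → ℕ
  hits []           []      = 0
  hits (tag ∷ tags) (x ∷ v) = 𝟙 (tag ∧ red x) + hits tags v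

  hits-tabulate : ∀ {k} (f : Fin k → Bool) (v : Vec (Fin n) k) →
                  hits (tabulate f) v ≡ ∑[ j < k ] 𝟙 (f j ∧ red (lookup v j))
  hits-tabulate f []      = refl
  hits-tabulate f (x ∷ v) = cong (𝟙 (f zero ∧ red x) +_) (hits-tabulate (f ∘ suc) v)

  blue : Fin n → Bool
  blue = not ∘ red

  free : (Fin n → Bool) → (Fin n → Bool) → ℕ
  free cls u = ∑[ y < n ] 𝟙 (cls y ∧ not (u y))

  free-insert : ∀ cls u x → cls x ≡ true → u x ≡ false → free cls u ≡ suc (free cls (insert u x))
  free-insert cls u x cx ux = begin
    ∑[ y < n ] 𝟙 (cls y ∧ not (u y))                                      ≡⟨ sum-cong-≗ split ⟩
    ∑[ y < n ] (𝟙 (cls y ∧ not (insert u x y)) + 𝟙 (does (x ≟ᶠ y)))       ≡⟨ ∑-distrib-+ {n} _ _ ⟩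
    free cls (insert u x) + ∑[ y < n ] 𝟙 (does (x ≟ᶠ y))                   ≡⟨ cong (free cls (insert u x) +_) (sum-δ x) ⟩
    free cls (insert u x) + 1                                             ≡⟨ +-comm _ 1 ⟩
    suc (free cls (insert u x))                                           ∎
    where
    open ≡-Reasoning
    split : ∀ y → 𝟙 (cls y ∧ not (u y)) ≡ 𝟙 (cls y ∧ not (insert u x y)) + 𝟙 (does (x ≟ᶠ y))
    split y with x ≟ᶠ y
    ... | yes refl rewrite cx | ux = refl
    ... | no _     rewrite ∨-identityʳ (u y) = sym (+-identityʳ _)

  free-insert-other : ∀ cls u x → cls x ≡ false → free cls u ≡ free cls (insert u x)
  free-insert-other cls u x cx = sum-cong-≗ same
    where
    same : ∀ y → 𝟙 (cls y ∧ not (u y)) ≡ 𝟙 (cls y ∧ not (insert u x y))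
    same y with x ≟ᶠ y
    ... | yes refl rewrite cx = refl
    ... | no _     rewrite ∨-identityʳ (u y) = refl

  counted : ∀ {k} → Vec Bool k → (Fin n → Bool) → ℕ → Vec (Fin n) k → ℕ
  counted tags u t v = 𝟙 (fresh u v ∧ does (hits tags v ≟ t))

  count-fresh : ∀ {k} (tags : Vec Bool k) u t →
    sumOver (counted tags u t) (allVecs n k) ≡ placements tags (free red u) (free blue u) t
  count-fresh []               u t = +-identityʳ _
  count-fresh {suc k} (tag ∷ tags) u t = begin
    sumOver (counted (tag ∷ tags) u t) (allVecs n (suc k))
      ≡⟨ sumOver-allVecs n k _ ⟩
    ∑[ x < n ] sumOver (λ w → counted (tag ∷ tags) u t (x ∷ w)) (allVecs n k)
      ≡⟨ sum-cong-≗ first-letter ⟩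
    ∑[ x < n ] (𝟙 (red x ∧ not (u x)) * R + 𝟙 (blue x ∧ not (u x)) * B)
      ≡⟨ ∑-distrib-+ {n} _ _ ⟩
    ∑[ x < n ] (𝟙 (red x ∧ not (u x)) * R) + ∑[ x < n ] (𝟙 (blue x ∧ not (u x)) * B)
      ≡⟨ cong₂ _+_ (*-distribʳ-sum {n} R _) (*-distribʳ-sum {n} B _) ⟨
    free red u * R + free blue u * B
      ∎
    where
    open ≡-Reasoning
    R = afterRed tag tags (free red u) (free blue u) t
    B = placements tags (free red u) (pred (free blue u)) t

    rest-red : ∀ x → u x ≡ false → red x ≡ true → ∀ t' →
      sumOver (counted tags (insert u x) t') (allVecs n k) ≡ placements tags (pred (free red u)) (free blue u) t'
    rest-red x ux rx t' = trans (count-fresh tags (insert u x) t')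
      (cong₂ (λ p q → placements tags p q t')
        (cong pred (sym (free-insert red u x rx ux))) (sym (free-insert-other blue u x (cong not rx))))

    rest-blue : ∀ x → u x ≡ false → red x ≡ false → ∀ t' →
      sumOver (counted tags (insert u x) t') (allVecs n k) ≡ placements tags (free red u) (pred (free blue u)) t'
    rest-blue x ux rx t' = trans (count-fresh tags (insert u x) t')
      (cong₂ (λ p q → placements tags p q t')
        (sym (free-insert-other red u x rx)) (cong pred (sym (free-insert blue u x (cong not rx) ux))))

    first-letter : ∀ x → sumOver (λ w → counted (tag ∷ tags) u t (x ∷ w)) (allVecs n k)
                         ≡ 𝟙 (red x ∧ not (u x)) * R + 𝟙 (blue x ∧ not (u x)) * B
    first-letter x with u x in ux | red x in rx
    ... | true  | true  = sumOver-zero (allVecs n k) (λ _ → refl)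
    ... | true  | false = sumOver-zero (allVecs n k) (λ _ → refl)
    ... | false | false =
      trans (sumOver-cong (allVecs n k) untagged) (trans (rest-blue x ux rx t) (sym (+-identityʳ B)))
      where
      untagged : ∀ w → 𝟙 (fresh (insert u x) w ∧ does (𝟙 (tag ∧ false) + hits tags w ≟ t)) ≡ counted tags (insert u x) t w
      untagged w rewrite ∧-zeroʳ tag = refl
    ... | false | true  = trans (red-first tag t) (sym (trans (+-identityʳ _) (+-identityʳ R)))
      where
      red-first : ∀ tag′ t′ →
        sumOver (λ w → 𝟙 (fresh (insert u x) w ∧ does (𝟙 (tag′ ∧ true) + hits tags w ≟ t′))) (allVecs n k)
          ≡ afterRed tag′ tags (free red u) (free blue u) t′
      red-first false t′       = rest-red x ux rx t′
      red-first true  zero     = sumOver-zero (allVecs n k) (λ w → cong 𝟙 (∧-zeroʳ (fresh (insert u x) w)))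
      red-first true  (suc t′) = rest-red x ux rx t′

csuc-≢ : ∀ {k} → 2 ≤ k → (i : Fin k) → csuc i ≢ i
csuc-≢ {suc k} 2≤k i csuc-i≡i = not-fixed (toℕ i) (toℕ<n i) (trans (sym (toℕ-fromℕ< _)) (cong toℕ csuc-i≡i))
  where
  not-fixed : ∀ j → j < suc k → suc j % suc k ≢ j
  not-fixed j j<k+1 e with suc j <? suc k
  ... | yes j+1<k+1 = 1+n≢n (trans (sym (m<n⇒m%n≡m j+1<k+1)) e)
  ... | no  j+1≮k+1 with ≤-antisym j<k+1 (≮⇒≥ j+1≮k+1)
  ... | refl = <-irrefl refl (subst (λ z → 2 ≤ suc z) (trans (sym e) (n%n≡0 (suc j))) 2≤k)

two-values : ∀ {h t s M} → 1 ≤ M → h + (t + t) ≡ M + s → s ≤ t → (t ≡ 1 → s ≡ 1) →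
             (h ≡ M ⇔ t ≡ 0) × (h ≡ M ∸ 1 ⇔ t ≡ 1)
two-values {h} {zero} {M = suc M} _ e z≤n _ =
  mk⇔ (λ _ → refl) (λ _ → h≡M+1) , mk⇔ (λ h≡M → ⊥-elim (1+n≢n (trans (sym h≡M+1) h≡M))) (λ ())
  where
  h≡M+1 : h ≡ suc M
  h≡M+1 = trans (sym (+-identityʳ h)) (trans e (+-identityʳ (suc M)))
two-values {h} {suc zero} {M = suc M} _ e _ s≡1 =
  mk⇔ (λ h≡M+1 → ⊥-elim (1+n≢n (trans (sym h≡M+1) h≡M))) (λ ()) , mk⇔ (λ _ → refl) (λ _ → h≡M)
  where
  h≡M : h ≡ M
  h≡M = +-cancelʳ-≡ 1 h M (suc-injective (trans (sym (+-suc h 1)) (trans e (cong (suc M +_) (s≡1 refl)))))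
two-values {h} {suc (suc k)} {s} {suc M} _ e s≤t _ =
  mk⇔ (λ h≡M+1 → ⊥-elim (m+1+n≰m (suc M) (subst (λ z → z + t ≤ suc M) h≡M+1 h+t≤M+1))) (λ ()) ,
  mk⇔ (λ h≡M → ⊥-elim (m+1+n≰m M (s≤s⁻¹ (subst (_≤ suc M) (+-suc M (suc k)) (M+t≤M+1 h≡M))))) (λ ())
  where
  t = suc (suc k)
  h+t≤M+1 : h + t ≤ suc M
  h+t≤M+1 = +-cancelʳ-≤ t (h + t) (suc M) (begin
    h + t + t      ≡⟨ +-assoc h t t ⟩
    h + (t + t)    ≡⟨ e ⟩
    suc M + s      ≤⟨ +-monoʳ-≤ (suc M) s≤t ⟩
    suc M + t      ∎)
    where open ≤-Reasoning
  M+t≤M+1 : h ≡ M → M + t ≤ suc M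
  M+t≤M+1 h≡M = subst (λ z → z + t ≤ suc M) h≡M h+t≤M+1

module CycleCommutation {n m : ℕ} (2≤m : 2 ≤ m) (β : Perm n) (a : Fin m → Fin n)
  (a-inj : Injective _≡_ _≡_ a) (β-cycle : ∀ i → lookup β (a i) ≡ a (csuc i))
  (β-fix : ∀ x → (∀ i → a i ≢ x) → lookup β x ≡ x) where

  β⟨_⟩ : Fin n → Fin n
  β⟨_⟩ = lookup β

  inSupp : Fin n → Bool
  inSupp x = does (any? (λ i → a i ≟ᶠ x))

  supp-size : ∑[ x < n ] 𝟙 (inSupp x) ≡ m
  supp-size = image-size a a-inj id sum-δ

  outside-size : ∑[ x < n ] 𝟙 (not (inSupp x)) ≡ n ∸ m
  outside-size = begin
    outside                                  ≡⟨ m+n∸m≡n m outside ⟨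
    m + outside ∸ m                          ≡⟨ cong (λ z → z + outside ∸ m) supp-size ⟨
    ∑[ x < n ] 𝟙 (inSupp x) + outside ∸ m   ≡⟨ cong (_∸ m) (∑-distrib-+ {n} _ _) ⟨
    ∑[ x < n ] (𝟙 (inSupp x) + 𝟙 (not (inSupp x))) ∸ m
                                             ≡⟨ cong (_∸ m) (sum-cong-≗ (𝟙-complement ∘ inSupp)) ⟩
    ∑[ x < n ] 1 ∸ m                         ≡⟨ cong (_∸ m) (sum-ones n) ⟩
    n ∸ m                                    ∎
    where
    open ≡-Reasoning
    outside = ∑[ x < n ] 𝟙 (not (inSupp x))

  β-moves : ∀ x → inSupp x ≡ true → inSupp β⟨ x ⟩ ≡ true × β⟨ x ⟩ ≢ x
  β-moves x x∈A with any? (λ i → a i ≟ᶠ x)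
  β-moves x refl | yes (i , refl) =
    subst (λ y → inSupp y ≡ true) (sym (β-cycle i)) (dec-true (any? (λ j → a j ≟ᶠ a (csuc i))) (csuc i , refl)) ,
    λ βx≡x → csuc-≢ 2≤m i (a-inj (trans (sym (β-cycle i)) βx≡x))

  β-fixes : ∀ x → inSupp x ≡ false → β⟨ x ⟩ ≡ x
  β-fixes x x∉A = β-fix x (λ i ai≡x → does-false⇒¬ (any? (λ j → a j ≟ᶠ x)) x∉A (i , ai≡x))

  module Commutator (α : Perm n) (α-inj : Injective _≡_ _≡_ (lookup α)) where

    α⟨_⟩ : Fin n → Fin n
    α⟨_⟩ = lookup α

    α-bijective : ∀ y → ∑[ x < n ] 𝟙 (does (y ≟ᶠ α⟨ x ⟩)) ≡ 1
    α-bijective y = trans (sum-cong-≗ (λ x → cong 𝟙 (≟-sym y α⟨ x ⟩))) (sum-all-one preimages at-most-one total y)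
      where
      preimages : Fin n → ℕ
      preimages y = ∑[ x < n ] 𝟙 (does (α⟨ x ⟩ ≟ᶠ y))
      at-most-one : ∀ y → preimages y ≤ 1
      at-most-one y = subst (_≤ 1) (sym (count-preimages α⟨_⟩ α-inj y)) (𝟙≤1 _)
      total : ∑[ y < n ] preimages y ≡ n
      total = trans (∑-comm (λ y x → 𝟙 (does (α⟨ x ⟩ ≟ᶠ y))))
                    (trans (sum-cong-≗ (λ x → sum-δ α⟨ x ⟩)) (sum-ones n))

    preimage-size : ∑[ x < n ] 𝟙 (inSupp α⟨ x ⟩) ≡ m
    preimage-size = image-size a a-inj α⟨_⟩ α-bijective

    mismatch : Fin n → Bool
    mismatch x = not (does (α⟨ β⟨ x ⟩ ⟩ ≟ᶠ β⟨ α⟨ x ⟩ ⟩))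

    H≡mismatches : H (α ∘ₚ β) (β ∘ₚ α) ≡ ∑[ x < n ] 𝟙 (mismatch x)
    H≡mismatches = trans (length-filter _ (allFin n)) (trans (sumOver-allFin n _)
      (sum-cong-≗ {n} (λ x → cong₂ (λ u v → 𝟙 (not (does (u ≟ᶠ v)))) (lookup∘tabulate _ x) (lookup∘tabulate _ x))))

    leaving entering staying staying-mismatch : Fin n → ℕ
    leaving          x = 𝟙 (inSupp x ∧ not (inSupp α⟨ x ⟩))
    entering         x = 𝟙 (inSupp α⟨ x ⟩ ∧ not (inSupp x))
    staying          x = 𝟙 (inSupp x ∧ inSupp α⟨ x ⟩)
    staying-mismatch x = 𝟙 ((inSupp x ∧ inSupp α⟨ x ⟩) ∧ mismatch x)

    -- Every leaving or entering point is a mismatch, and points outside A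
    -- that α keeps outside A are not.
    mismatch-split : ∀ x → 𝟙 (mismatch x) ≡ leaving x + entering x + staying-mismatch x
    mismatch-split x with inSupp x in x∈A | inSupp α⟨ x ⟩ in αx∈A
    ... | true  | true  = refl
    ... | true  | false rewrite β-fixes α⟨ x ⟩ αx∈A =
      cong (𝟙 ∘ not) (dec-false (α⟨ β⟨ x ⟩ ⟩ ≟ᶠ α⟨ x ⟩) (proj₂ (β-moves x x∈A) ∘ α-inj))
    ... | false | true  rewrite β-fixes x x∈A =
      cong (𝟙 ∘ not) (dec-false (α⟨ x ⟩ ≟ᶠ β⟨ α⟨ x ⟩ ⟩) (proj₂ (β-moves α⟨ x ⟩ αx∈A) ∘ sym))
    ... | false | false rewrite β-fixes x x∈A | β-fixes α⟨ x ⟩ αx∈A =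
      cong (𝟙 ∘ not) (dec-true (α⟨ x ⟩ ≟ᶠ α⟨ x ⟩) refl)

    stay : ℕ
    stay = sum staying

    leaving+stay : sum leaving + stay ≡ m
    leaving+stay = trans (sym (∑-distrib-+ {n} leaving staying))
      (trans (sum-cong-≗ (λ x → sym (𝟙-split (inSupp x) (inSupp α⟨ x ⟩)))) supp-size)

    entering+stay : sum entering + stay ≡ m
    entering+stay = trans (sym (∑-distrib-+ {n} entering staying))
      (trans (sum-cong-≗ (λ x → sym (split x))) preimage-size)
      where
      split : ∀ x → 𝟙 (inSupp α⟨ x ⟩) ≡ entering x + staying x
      split x = trans (𝟙-split (inSupp α⟨ x ⟩) (inSupp x))
                      (cong (λ z → entering x + 𝟙 z) (∧-comm (inSupp α⟨ x ⟩) (inSupp x)))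

    -- If x is the only point of A kept in A by α, then x is a mismatch:
    -- otherwise βx ≠ x would be a second such point, as αβx = βαx ∈ A.
    lone-stayer-mismatch : stay ≡ 1 → ∀ x → staying-mismatch x ≡ staying x
    lone-stayer-mismatch stay≡1 x with inSupp x in x∈A | inSupp α⟨ x ⟩ in αx∈A
    ... | true  | true  = is-mismatch
      where
      is-mismatch : 𝟙 (not (does (α⟨ β⟨ x ⟩ ⟩ ≟ᶠ β⟨ α⟨ x ⟩ ⟩))) ≡ 1
      is-mismatch with α⟨ β⟨ x ⟩ ⟩ ≟ᶠ β⟨ α⟨ x ⟩ ⟩
      ... | no  _       = refl
      ... | yes commute = ⊥-elim (1+n≰n (subst (2 ≤_) stay≡1
              (subst₂ (λ u v → u + v ≤ stay) x-stays βx-stays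
                (sum-≥-pair staying (≢-sym (proj₂ (β-moves x x∈A)))))))
        where
        x-stays : staying x ≡ 1
        x-stays rewrite x∈A | αx∈A = refl
        βx-stays : staying β⟨ x ⟩ ≡ 1
        βx-stays rewrite proj₁ (β-moves x x∈A) | commute | proj₁ (β-moves α⟨ x ⟩ αx∈A) = refl
    ... | true  | false = refl
    ... | false | true  = refl
    ... | false | false = refl

    H+2stay : H (α ∘ₚ β) (β ∘ₚ α) + (stay + stay) ≡ 2 * m + sum staying-mismatch
    H+2stay = begin
      H (α ∘ₚ β) (β ∘ₚ α) + (stay + stay)     ≡⟨ cong (_+ (stay + stay)) H≡parts ⟩
      L + E + S + (stay + stay)               ≡⟨ regroup L E S stay ⟩
      (L + stay) + ((E + stay) + 0) + S       ≡⟨ cong₂ (λ u v → u + (v + 0) + S) leaving+stay entering+stay ⟩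
      2 * m + S                               ∎
      where
      open ≡-Reasoning
      L = sum leaving
      E = sum entering
      S = sum staying-mismatch
      H≡parts : H (α ∘ₚ β) (β ∘ₚ α) ≡ L + E + S
      H≡parts = trans H≡mismatches (trans (sum-cong-≗ mismatch-split)
                  (trans (∑-distrib-+ {n} _ staying-mismatch) (cong (_+ S) (∑-distrib-+ {n} leaving entering))))
      regroup : ∀ l e s t → l + e + s + (t + t) ≡ (l + t) + ((e + t) + 0) + s
      regroup = solve-∀

    H-values : (H (α ∘ₚ β) (β ∘ₚ α) ≡ 2 * m ⇔ stay ≡ 0) × (H (α ∘ₚ β) (β ∘ₚ α) ≡ 2 * m ∸ 1 ⇔ stay ≡ 1)
    H-values = two-values 1≤2m H+2stay (sum-mono-≤ (λ x → 𝟙-∧-≤ _ (mismatch x)))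
                 (λ stay≡1 → trans (sum-cong-≗ (lone-stayer-mismatch stay≡1)) stay≡1)
      where
      1≤2m : 1 ≤ 2 * m
      1≤2m = ≤-trans (≤-trans (s≤s z≤n) 2≤m) (m≤m+n m (m + 0))

  -- Counting α through its table: tag each position by membership of A, so
  -- that the hits of the table α are exactly the points α keeps in A.
  open FreshWords inSupp

  tags : Vec Bool n
  tags = tabulate inSupp

  reds-tags : reds tags ≡ m
  reds-tags = trans (reds-tabulate inSupp) supp-size

  blues-tags : blues tags ≡ n ∸ m
  blues-tags = trans (blues-tabulate inSupp) outside-size

  c≡placements : ∀ k t →
    (∀ α (α-inj : Injective _≡_ _≡_ (lookup α)) → H (α ∘ₚ β) (β ∘ₚ α) ≡ k ⇔ Commutator.stay α α-inj ≡ t) →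
    c k β ≡ placements tags m (n ∸ m) t
  c≡placements k t H⇔stay = begin
    c k β
      ≡⟨ length-filter _ (allVecs n n) ⟩
    sumOver (λ α → 𝟙 (does (isPerm? α) ∧ does (H (α ∘ₚ β) (β ∘ₚ α) ≟ k))) (allVecs n n)
      ≡⟨ sumOver-cong (allVecs n n) weight ⟩
    sumOver (counted tags ∅ t) (allVecs n n)
      ≡⟨ count-fresh tags ∅ t ⟩
    placements tags (free inSupp ∅) (free blue ∅) t
      ≡⟨ cong₂ (λ p q → placements tags p q t) red-free blue-free ⟩
    placements tags m (n ∸ m) t
      ∎
    where
    open ≡-Reasoning
    weight : ∀ α → 𝟙 (does (isPerm? α) ∧ does (H (α ∘ₚ β) (β ∘ₚ α) ≟ k)) ≡ counted tags ∅ t α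
    weight α rewrite isPerm≡fresh α with fresh ∅ α in fresh-α
    ... | false = refl
    ... | true  = cong 𝟙 (does-⇔ H⇔hits (H (α ∘ₚ β) (β ∘ₚ α) ≟ k) (hits tags α ≟ t))
      where
      H⇔hits : H (α ∘ₚ β) (β ∘ₚ α) ≡ k ⇔ hits tags α ≡ t
      H⇔hits = subst (λ z → H (α ∘ₚ β) (β ∘ₚ α) ≡ k ⇔ z ≡ t) (sym (hits-tabulate inSupp α))
                     (H⇔stay α (fresh-injective ∅ α fresh-α))
    red-free : free inSupp ∅ ≡ m
    red-free = trans (sum-cong-≗ (λ y → cong 𝟙 (∧-identityʳ (inSupp y)))) supp-size
    blue-free : free blue ∅ ≡ n ∸ m
    blue-free = trans (sum-cong-≗ (λ y → cong 𝟙 (∧-identityʳ (blue y)))) outside-size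

  placement-sizes : m + (n ∸ m) ≡ reds tags + blues tags
  placement-sizes = sym (cong₂ _+_ reds-tags blues-tags)

  no-stay-count : c (2 * m) β ≡ (n ∸ m) ↓ m * (n ∸ m) !
  no-stay-count = begin
    c (2 * m) β                          ≡⟨ c≡placements (2 * m) 0 (λ α α-inj → proj₁ (Commutator.H-values α α-inj)) ⟩
    placements tags m (n ∸ m) 0          ≡⟨ placements-0 tags m (n ∸ m) placement-sizes ⟩
    (n ∸ m) ↓ reds tags * blues tags !   ≡⟨ cong₂ (λ r b → (n ∸ m) ↓ r * b !) reds-tags blues-tags ⟩
    (n ∸ m) ↓ m * (n ∸ m) !              ∎
    where open ≡-Reasoning

  one-stay-count : c (2 * m ∸ 1) β ≡ m * m * ((n ∸ m) ↓ pred m) * (n ∸ m) !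
  one-stay-count = begin
    c (2 * m ∸ 1) β                      ≡⟨ c≡placements (2 * m ∸ 1) 1 (λ α α-inj → proj₂ (Commutator.H-values α α-inj)) ⟩
    placements tags m (n ∸ m) 1          ≡⟨ placements-1 tags m (n ∸ m) placement-sizes ⟩
    reds tags * m * ((n ∸ m) ↓ pred (reds tags)) * blues tags !
                                         ≡⟨ cong₂ (λ r b → r * m * ((n ∸ m) ↓ pred r) * b !) reds-tags blues-tags ⟩
    m * m * ((n ∸ m) ↓ pred m) * (n ∸ m) ! ∎
    where open ≡-Reasoning

proposition3p2 : (n m : ℕ) → 2 ≤ m → 2 * m ∸ 1 ≤ n →
    (β : Perm n) → IsCycle m β →
    (c (2 * m) β ≡ (m !) * ((n ∸ m) !) * ((n ∸ m) C m))
    × (c (2 * m ∸ 1) β ≡ m * ((n ∸ m) !) * (m !) * ((n ∸ m) C (m ∸ 1)))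
proposition3p2 n m 2≤m _ β (_ , a , a-inj , β-cycle , β-fix) =
  trans no-stay-count  (closed-form-0 (n ∸ m) m) ,
  trans one-stay-count (closed-form-1 (n ∸ m) m)
  where open CycleCommutation 2≤m β a a-inj β-cycle β-fix
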